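{- Let $L$ be the infinite path, the undirected graph with vertex set $\mathbb{N}$ whose edges are the pairs $\{i,i+1\}$, $i\in\mathbb{N}$. Then for every $n\in\mathbb{N}$, $$NN(L,n)\geq 2^{\lfloor n/2\rfloor},$$ and consequently $RR(L)\geq \frac12$.
   Context: For an undirected graph $G$ with vertex set $\mathbb{N}$, two permutations $\pi,\rho$ of $[n]=\{1,\dots,n\}$ are called robustly $G$-different if there exist $i,j\in[n]$ such that $(\pi(i),\rho(i))=(\rho(j),\pi(j))$ and $\{\pi(i),\rho(i)\}\in E(G)$. $NN(G,n)$ is the maximum cardinality of a set of pairwise robustly $G$-different permutations of $[n]$, and the robust permutation capacity is $RR(G)=\lim_{n\to\infty}\frac1n\log NN(G,n)$. Logarithms are to base 2. -}

module Defs where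

open import Data.Nat using (ℕ; suc)
open import Data.Fin using (Fin; toℕ)
open import Data.Fin.Permutation using (Permutation′; _⟨$⟩ʳ_)
open import Data.Product using (∃₂; _×_)
open import Data.Sum using (_⊎_)
open import Relation.Binary.PropositionalEquality using (_≡_)

-- An undirected graph on vertex set ℕ, given by its edge relation
-- (an edge {a,b} is witnessed by Edge a b; the relation is used symmetrically).
GraphOnℕ : Set₁
GraphOnℕ = ℕ → ℕ → Set

L : GraphOnℕ
L a b = (b ≡ suc a) ⊎ (a ≡ suc b)

-- [n] = {1,…,n} is represented by Fin n via k ↦ 1 + toℕ k.
elem : ∀ {n} → Fin n → ℕ
elem k = suc (toℕ k)

app : ∀ {n} → Permutation′ n → Fin n → ℕ
app π i = elem (π ⟨$⟩ʳ i)

RobustlyDifferent : (G : GraphOnℕ) {n : ℕ} → Permutation′ n → Permutation′ n → Set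
RobustlyDifferent G π ρ =
  ∃₂ λ i j → (app π i ≡ app ρ j) × (app ρ i ≡ app π j) × G (app π i) (app ρ i)

{-# OPTIONS --safe #-}
module Submission where

-- A permutation of [2k] is chosen by deciding, for each block {2i−1, 2i}, whether to
-- swap it or not; this gives 2^k permutations. Two different choices disagree on some
-- block: one fixes it and the other swaps it, so on that block the two permutations
-- exchange the adjacent values 2i−1 and 2i, which is an edge of the path. An odd n
-- leaves its last point fixed.

open import Defs
open import Data.Nat using (ℕ; zero; suc; _^_; _/_; ⌊_/2⌋; s≤s; z≤n)
open import Data.Nat.DivMod using (m/n≡1+[m∸n]/n)
open import Data.Fin using (Fin; remQuot; combine; _≟_) renaming (zero to 0F; suc to fs)
open import Data.Fin.Properties using (combine-remQuot)
open import Data.Fin.Permutation using (Permutation′; id; lift₀; swap)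
open import Data.Product using (Σ; _,_; _×_; uncurry)
open import Data.Sum using (inj₁; inj₂)
open import Function using (_∘_)
open import Function.Definitions using (Injective)
open import Relation.Binary.PropositionalEquality
  using (_≡_; _≢_; refl; sym; trans; cong; subst; subst₂)
open Relation.Binary.PropositionalEquality.≡-Reasoning
open import Relation.Nullary using (contradiction; yes; no)

RobustFamily : GraphOnℕ → ℕ → Set → Set
RobustFamily G n I =
  Σ (I → Permutation′ n) λ f → (a b : I) → a ≢ b → RobustlyDifferent G (f a) (f b)

reindex : ∀ {G n I J} (g : J → I) → Injective _≡_ _≡_ g →
          RobustFamily G n I → RobustFamily G n J
reindex g g-inj (f , f-robust) = f ∘ g , λ a b a≢b → f-robust (g a) (g b) (a≢b ∘ g-inj)

singletonFamily : ∀ {G n} → Permutation′ n → RobustFamily G n (Fin 1)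
singletonFamily π = (λ _ → π) , λ { 0F 0F 0≢0 → contradiction refl 0≢0 }

remQuot-injective : ∀ {m} n → Injective _≡_ _≡_ (remQuot {m} n)
remQuot-injective {m} n {a} {b} eq = begin
  a                                ≡⟨ sym (combine-remQuot {m} n a) ⟩
  uncurry combine (remQuot {m} n a) ≡⟨ cong (uncurry combine) eq ⟩
  uncurry combine (remQuot {m} n b) ≡⟨ combine-remQuot {m} n b ⟩
  b                                ∎

ShiftInvariant₂ : GraphOnℕ → Set
ShiftInvariant₂ G = ∀ {a b} → G a b → G (suc (suc a)) (suc (suc b))

prefixBlock : ∀ {k} → Fin 2 → Permutation′ k → Permutation′ (suc (suc k))
prefixBlock 0F π = lift₀ (lift₀ π)
prefixBlock (fs 0F) π = swap π

app-prefixBlock : ∀ {k} (h : Fin 2) (π : Permutation′ k) (i : Fin k) →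
                  app (prefixBlock h π) (fs (fs i)) ≡ suc (suc (app π i))
app-prefixBlock 0F π i = refl
app-prefixBlock (fs 0F) π i = refl

robustlyDifferent-prefixBlock-tail :
  ∀ {G k} → ShiftInvariant₂ G → (h h′ : Fin 2) {π ρ : Permutation′ k} →
  RobustlyDifferent G π ρ → RobustlyDifferent G (prefixBlock h π) (prefixBlock h′ ρ)
robustlyDifferent-prefixBlock-tail {G} shift h h′ {π} {ρ} (i , j , πi≡ρj , ρi≡πj , edge) =
  fs (fs i) , fs (fs j) ,
  lift₂ (app-prefixBlock h π i) (app-prefixBlock h′ ρ j) πi≡ρj ,
  lift₂ (app-prefixBlock h′ ρ i) (app-prefixBlock h π j) ρi≡πj ,
  subst₂ G (sym (app-prefixBlock h π i)) (sym (app-prefixBlock h′ ρ i)) (shift edge)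
  where
  lift₂ : ∀ {x y u v} → x ≡ suc (suc u) → y ≡ suc (suc v) → u ≡ v → x ≡ y
  lift₂ x≡ y≡ u≡v = trans x≡ (trans (cong (suc ∘ suc) u≡v) (sym y≡))

robustlyDifferent-prefixBlock-head :
  ∀ {G k} → G 1 2 → G 2 1 → (h h′ : Fin 2) → h ≢ h′ → (π ρ : Permutation′ k) →
  RobustlyDifferent G (prefixBlock h π) (prefixBlock h′ ρ)
robustlyDifferent-prefixBlock-head e₁₂ _ 0F (fs 0F) _ _ _ = 0F , fs 0F , refl , refl , e₁₂
robustlyDifferent-prefixBlock-head _ e₂₁ (fs 0F) 0F _ _ _ = 0F , fs 0F , refl , refl , e₂₁
robustlyDifferent-prefixBlock-head _ _ 0F 0F 0≢0 _ _ = contradiction refl 0≢0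
robustlyDifferent-prefixBlock-head _ _ (fs 0F) (fs 0F) 1≢1 _ _ = contradiction refl 1≢1

doubleFamily : ∀ {G k I} → ShiftInvariant₂ G → G 1 2 → G 2 1 →
               RobustFamily G k I → RobustFamily G (suc (suc k)) (Fin 2 × I)
doubleFamily {G} {k} {I} shift e₁₂ e₂₁ (f , f-robust) = F , F-robust
  where
  F : Fin 2 × I → Permutation′ (suc (suc k))
  F (h , a) = prefixBlock h (f a)
  F-robust : ∀ x y → x ≢ y → RobustlyDifferent G (F x) (F y)
  F-robust (h , a) (h′ , b) x≢y with h ≟ h′
  ... | no h≢h′ = robustlyDifferent-prefixBlock-head {G} e₁₂ e₂₁ h h′ h≢h′ (f a) (f b)
  ... | yes refl = robustlyDifferent-prefixBlock-tail {G} shift h h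
                     (f-robust a b λ { refl → x≢y refl })

L-shiftInvariant₂ : ShiftInvariant₂ L
L-shiftInvariant₂ (inj₁ b≡1+a) = inj₁ (cong (suc ∘ suc) b≡1+a)
L-shiftInvariant₂ (inj₂ a≡1+b) = inj₂ (cong (suc ∘ suc) a≡1+b)

pathFamily : ∀ n → RobustFamily L n (Fin (2 ^ ⌊ n /2⌋))
pathFamily zero = singletonFamily {L} id
pathFamily (suc zero) = singletonFamily {L} id
pathFamily (suc (suc n)) =
  reindex {L} (remQuot (2 ^ ⌊ n /2⌋)) (remQuot-injective {2} (2 ^ ⌊ n /2⌋))
    (doubleFamily {L} L-shiftInvariant₂ (inj₁ refl) (inj₂ refl) (pathFamily n))

⌊n/2⌋≡n/2 : ∀ n → ⌊ n /2⌋ ≡ n / 2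
⌊n/2⌋≡n/2 zero = refl
⌊n/2⌋≡n/2 (suc zero) = refl
⌊n/2⌋≡n/2 (suc (suc n)) =
  trans (cong suc (⌊n/2⌋≡n/2 n)) (sym (m/n≡1+[m∸n]/n {suc (suc n)} {2} (s≤s (s≤s z≤n))))

lemma2 : (n : ℕ) →
    Σ (Fin (2 ^ (n / 2)) → Permutation′ n) λ f →
      (a b : Fin (2 ^ (n / 2))) → a ≢ b → RobustlyDifferent L (f a) (f b)
lemma2 n = subst (λ m → RobustFamily L n (Fin (2 ^ m))) (⌊n/2⌋≡n/2 n) (pathFamily n)
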